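{- Let $\Gamma$ be a finite $G$-arc-transitive digraph, where $G\leq\mathrm{Aut}(\Gamma)$. Then: (i) if $\Gamma$ has valency at most $5$, then $\Gamma$ is $(G,2)$-geodesic-transitive if and only if $\Gamma$ is $(G,2)$-arc-transitive; (ii) if $\Gamma$ is $(G,2)$-geodesic-transitive of diameter $2$, then $\Gamma$ is a balanced incomplete block design with the Hadamard parameters.
   Context: A digraph $\Gamma$ consists of a finite vertex set $V(\Gamma)$ with an antisymmetric irreflexive relation $\rightarrow$; an arc is an ordered pair $(u,v)$ with $u\rightarrow v$. $\Gamma^+(v)=\{u: v\rightarrow u\}$; a $G$-arc-transitive digraph is regular, and its valency is $|\Gamma^+(v)|$. The distance $d_\Gamma(u,v)$ is the length of a shortest directed path from $u$ to $v$ and the diameter is the maximum distance. An $s$-arc is a sequence $(v_0,\dots,v_s)$ with $v_i\rightarrow v_{i+1}$ for all $i$; it is an $s$-geodesic if $d_\Gamma(v_0,v_s)=s$. $\Gamma$ is $G$-arc-transitive if $G$ is transitive on arcs, $(G,2)$-arc-transitive if $G$ is transitive on $2$-arcs, and $(G,s)$-geodesic-transitive if $G$ is transitive on the set of $i$-geodesics for each $i\leq s$. "A balanced incomplete block design with the Hadamard parameters" means: taking the vertices as points and the out-neighbourhoods $\Gamma^+(v)$ as blocks gives a symmetric $2$-$(4t-1,2t-1,t-1)$ design for some integer $t\geq 1$. -}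

module Defs where

open import Level using (Level; suc; _⊔_)
open import Data.Nat as ℕ using (ℕ; zero; _+_; _*_; _≤_; _<_)
open import Data.Bool using (Bool; true; false; T; _∧_)
open import Data.Fin using (Fin)
open import Data.Fin.Permutation using (Permutation′; _⟨$⟩ʳ_; id; flip; _∘ₚ_; _≈_)
open import Data.Vec using (Vec; []; _∷_; head; last; map)
open import Data.List using (length; filterᵇ; allFin)
open import Data.Product using (Σ; ∃; ∃-syntax; _×_; _,_)
open import Relation.Nullary using (¬_)
open import Relation.Binary.PropositionalEquality using (_≡_; _≢_)

record Digraph (n : ℕ) : Set where
  field
    adj      : Fin n → Fin n → Bool
    irrefl   : ∀ v → ¬ T (adj v v)
    antisym  : ∀ u v → T (adj u v) → ¬ T (adj v u)
open Digraph public

module _ {n : ℕ} (Γ : Digraph n) where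

  Arc : Fin n → Fin n → Set
  Arc u v = T (adj Γ u v)

  outDeg : Fin n → ℕ
  outDeg v = length (filterᵇ (adj Γ v) (allFin n))

  data Walk : ℕ → Fin n → Fin n → Set where
    here : ∀ {u} → Walk zero u u
    step : ∀ {k u w v} → Arc u w → Walk k w v → Walk (ℕ.suc k) u v

  Dist : Fin n → Fin n → ℕ → Set
  Dist u v d = Walk d u v × (∀ k → k < d → ¬ Walk k u v)

  IsSArc : ∀ {s} → Vec (Fin n) (ℕ.suc s) → Set
  IsSArc (v ∷ [])     = Data.Unit.⊤ where import Data.Unit
  IsSArc (u ∷ v ∷ vs) = Arc u v × IsSArc (v ∷ vs)

  IsGeodesic : ∀ s → Vec (Fin n) (ℕ.suc s) → Set
  IsGeodesic s vs = IsSArc vs × Dist (head vs) (last vs) s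

  HasDiameter : ℕ → Set
  HasDiameter D = (∀ u v → ∃[ d ] (d ≤ D × Dist u v d))
                × (∃[ u ] ∃[ v ] Dist u v D)

  IsAut : Permutation′ n → Set
  IsAut g = ∀ u v → adj Γ (g ⟨$⟩ʳ u) (g ⟨$⟩ʳ v) ≡ adj Γ u v

record SubgroupOfAut {n : ℕ} (Γ : Digraph n) : Set₁ where
  field
    member  : Permutation′ n → Set
    ∈-resp  : ∀ {g h} → g ≈ h → member g → member h
    id∈     : member id
    ∘∈      : ∀ {g h} → member g → member h → member (g ∘ₚ h)
    inv∈    : ∀ {g} → member g → member (flip g)
    ⊆Aut    : ∀ {g} → member g → IsAut Γ g
open SubgroupOfAut public

module _ {n : ℕ} {Γ : Digraph n} (G : SubgroupOfAut Γ) where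

  TransitiveOn : ∀ {m} → (Vec (Fin n) m → Set) → Set
  TransitiveOn P = ∀ x y → P x → P y →
                   ∃[ g ] (member G g × map (g ⟨$⟩ʳ_) x ≡ y)

  -- G-arc-transitive: G transitive on vertices and on arcs
  -- (the convention under which a G-arc-transitive digraph is regular)
  ArcTransitive : Set
  ArcTransitive = TransitiveOn {1} (λ _ → Data.Unit.⊤)
                × TransitiveOn {2} (IsSArc Γ)
    where import Data.Unit

  TwoArcTransitive : Set
  TwoArcTransitive = TransitiveOn {3} (IsSArc Γ)

  GeodesicTransitive : ℕ → Set
  GeodesicTransitive s = ∀ i → i ≤ s → TransitiveOn (IsGeodesic Γ i)

-- Points = vertices, blocks = out-neighbourhoods Γ⁺(v), forming a
-- symmetric 2-(4t-1, 2t-1, t-1) design for some t ≥ 1.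
HadamardDesign : ∀ {n} → Digraph n → Set
HadamardDesign {n} Γ =
  ∃[ t ] (1 ≤ t
         × n + 1 ≡ 4 * t
         × (∀ v → outDeg Γ v + 1 ≡ 2 * t)
         × (∀ x y → x ≢ y →
              length (filterᵇ (λ v → adj Γ v x ∧ adj Γ v y) (allFin n)) + 1 ≡ t))

-- Arc-transitivity makes a = |Γ⁺(x) ∩ Γ⁺(y)| independent of the arc x → y, and double
-- counting transitive triangles shows that |Γ⁻(x) ∩ Γ⁻(y)| and the number of 2-arcs from x
-- to y equal a as well.
--
-- (ii) Every in-neighbour of u lies at distance 2 from u, so with diameter 2 geodesic-
-- transitivity puts every vertex at distance 2 from u into Γ⁻(u): Γ is a tournament. Splitting
-- the out- and in-neighbourhoods along an arc then gives n = 4a + 3, valency 2a + 1 and λ = a.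
--
-- (i) 2-arc-transitivity always gives 2-geodesic-transitivity; for the converse it suffices
-- that there is no transitive triangle u → v → w, u → w. Such a triangle gives 1 ≤ a, and
-- {w} ⊔ (Γ⁺(v) ∩ Γ⁺(w)) ⊔ (Γ⁺(v) ∩ Γ⁻(w)) ⊆ Γ⁺(v) gives 2a + 1 ≤ 5, so a ∈ {1, 2}. Then
-- Γ⁺(v) ∖ Γ⁺(u) contains two vertices at distance 2 from u, and some g ∈ G fixing u and v
-- maps one to the other. But such a g fixes Γ⁺(v) pointwise. The blocks Γ⁺(v) ∩ Γ⁺(y) and
-- Γ⁺(v) ∩ Γ⁻(y) (y ∈ Γ⁺(v)) have a ≤ 2 elements, so g fixes them pointwise whenever it fixes
-- y and they are pairwise adjacent. For a = 2, Γ⁺(v) is a tournament, and fixed points spread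
-- from w to all of Γ⁺(v); for a = 1, the fixed and the moved out-neighbours of v would each
-- contain a 2-arc, six vertices in all.

module Submission where

open import Defs
open import Data.Nat using (ℕ; _≤_)
open import Data.Product using (_×_)
open import Function.Bundles using (_⇔_)

open import Data.Nat as ℕ using (zero; suc; _+_; _*_; z≤n; s≤s; >-nonZero)
open import Data.Nat.Properties hiding (_≟_)
open import Data.Nat.Solver using (module +-*-Solver)
open import Algebra.Properties.Semiring.Sum +-*-semiring
  using (sum; sum-cong-≗; ∑-distrib-+; ∑-comm; ∑-permute; *-distribˡ-sum; *-distribʳ-sum)
open import Data.Bool using (Bool; true; false; T; _∧_; not)
open import Data.Bool.Properties using (T?; ∧-comm)
open import Data.Fin using (Fin; zero; suc; _≟_)
open import Data.Fin.Permutation using (Permutation′; _⟨$⟩ʳ_)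
open import Data.List using (List; []; _∷_; length; filterᵇ; tabulate; allFin)
open import Data.List.Relation.Unary.All using (All; []; _∷_)
open import Data.List.Relation.Unary.AllPairs using (AllPairs; []; _∷_)
open import Data.Vec using ([]; _∷_)
open import Data.Vec.Properties using (∷-injective)
open import Data.Product using (∃; ∃₂; ∃-syntax; _,_; proj₁; proj₂)
open import Data.Sum using (_⊎_; inj₁; inj₂; [_,_]; [_,_]′; map₂)
open import Data.Empty using (⊥; ⊥-elim)
open import Data.Unit using (tt)
open import Function using (_∘_; id)
open import Function.Bundles using (Injection; mk⇔)
open import Function.Properties.Inverse using (↔⇒↣)
open import Relation.Nullary using (¬_; yes; no)
open import Relation.Nullary.Decidable
  using (⌊_⌋; toWitness; fromWitness; toWitnessFalse; fromWitnessFalse)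
open import Relation.Binary.PropositionalEquality hiding ([_])

private variable
  n : ℕ
  P Q : Fin n → Bool
  i j : Fin n

-- Counting Boolean predicates on Fin n

𝟙 : Bool → ℕ
𝟙 true  = 1
𝟙 false = 0

count : (Fin n → Bool) → ℕ
count P = sum (𝟙 ∘ P)

_⊆ᵇ_ : (Fin n → Bool) → (Fin n → Bool) → Set
P ⊆ᵇ Q = ∀ w → T (P w) → T (Q w)

_≡ᵇ_ : Fin n → Fin n → Bool
w ≡ᵇ x = ⌊ w ≟ x ⌋

_∖_ : (Fin n → Bool) → Fin n → Fin n → Bool
(P ∖ x) w = P w ∧ not (w ≡ᵇ x)

∧-intro : ∀ {b c} → T b → T c → T (b ∧ c)
∧-intro {true} _ c = c

∧-proj₁ : ∀ {b c} → T (b ∧ c) → T b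
∧-proj₁ {true} _ = tt

∧-proj₂ : ∀ {b c} → T (b ∧ c) → T c
∧-proj₂ {true} c = c

≡ᵇ⊎≢ : (i j : Fin n) → T (i ≡ᵇ j) ⊎ i ≢ j
≡ᵇ⊎≢ i j with i ≟ j
... | yes _   = inj₁ tt
... | no  i≢j = inj₂ i≢j

∖-intro : (P : Fin n → Bool) → T (P i) → i ≢ j → T ((P ∖ j) i)
∖-intro {i = i} {j} P pi i≢j = ∧-intro {P i} pi (fromWitnessFalse {a? = i ≟ j} i≢j)

∖-elim : (P : Fin n → Bool) → T ((P ∖ j) i) → T (P i) × i ≢ j
∖-elim {j = j} {i} P t = ∧-proj₁ {P i} t , toWitnessFalse {a? = i ≟ j} (∧-proj₂ {P i} t)

length-filterᵇ-tabulate : ∀ {A : Set} {m} (P : A → Bool) (f : Fin m → A) →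
                          length (filterᵇ P (tabulate f)) ≡ count (P ∘ f)
length-filterᵇ-tabulate {m = zero}  P f = refl
length-filterᵇ-tabulate {m = suc m} P f with P (f zero)
... | true  = cong suc (length-filterᵇ-tabulate P (f ∘ suc))
... | false = length-filterᵇ-tabulate P (f ∘ suc)

∑-mono-≤ : {f g : Fin n → ℕ} → (∀ i → f i ≤ g i) → sum f ≤ sum g
∑-mono-≤ {zero}  _   = z≤n
∑-mono-≤ {suc n} f≤g = +-mono-≤ (f≤g zero) (∑-mono-≤ (f≤g ∘ suc))

term≤∑ : (f : Fin n → ℕ) (i : Fin n) → f i ≤ sum f
term≤∑ f zero    = m≤m+n _ _
term≤∑ f (suc i) = ≤-trans (term≤∑ (f ∘ suc) i) (m≤n+m _ _)

count-cong : (∀ w → P w ≡ Q w) → count P ≡ count Q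
count-cong P≗Q = sum-cong-≗ (cong 𝟙 ∘ P≗Q)

count-permute : (π : Permutation′ n) (P : Fin n → Bool) → count (P ∘ (π ⟨$⟩ʳ_)) ≡ count P
count-permute π P = sym (∑-permute (𝟙 ∘ P) π)

count-true : ∀ n → count {n} (λ _ → true) ≡ n
count-true zero    = refl
count-true (suc n) = cong suc (count-true n)

count-false : ∀ n → count {n} (λ _ → false) ≡ 0
count-false zero    = refl
count-false (suc n) = count-false n

count-≡ᵇ : (x : Fin n) → count (_≡ᵇ x) ≡ 1
count-≡ᵇ {suc n} zero    = cong suc (count-false n)
count-≡ᵇ {suc n} (suc x) = trans (count-cong {P = λ i → suc i ≡ᵇ suc x} suc-≡ᵇ-suc) (count-≡ᵇ x)
  where
  suc-≡ᵇ-suc : ∀ i → (suc i ≡ᵇ suc x) ≡ (i ≡ᵇ x)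
  suc-≡ᵇ-suc i with i ≟ x
  ... | yes _ = refl
  ... | no  _ = refl

count-split : (P Q R : Fin n → Bool) →
              (∀ w → T (P w) → T (Q w) ⊎ T (R w)) → Q ⊆ᵇ P → R ⊆ᵇ P →
              (∀ w → T (Q w) → ¬ T (R w)) →
              count P ≡ count Q + count R
count-split P Q R cover Q⊆P R⊆P disjoint =
  trans (sum-cong-≗ λ w → 𝟙-split (cover w) (Q⊆P w) (R⊆P w) (disjoint w))
        (∑-distrib-+ (𝟙 ∘ Q) (𝟙 ∘ R))
  where
  𝟙-split : ∀ {p q r} → (T p → T q ⊎ T r) → (T q → T p) → (T r → T p) → (T q → ¬ T r) →
            𝟙 p ≡ 𝟙 q + 𝟙 r
  𝟙-split {false} {false} {false} _     _   _   _    = refl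
  𝟙-split {false} {false} {true}  _     _   r⇒p _    = ⊥-elim (r⇒p tt)
  𝟙-split {false} {true}          _     q⇒p _   _    = ⊥-elim (q⇒p tt)
  𝟙-split {true}  {false} {false} cover _   _   _    = [ (λ ()) , (λ ()) ] (cover tt)
  𝟙-split {true}  {false} {true}  _     _   _   _    = refl
  𝟙-split {true}  {true}  {false} _     _   _   _    = refl
  𝟙-split {true}  {true}  {true}  _     _   _   disj = ⊥-elim (disj tt tt)

count-≤-split : (P Q R : Fin n → Bool) → Q ⊆ᵇ P → R ⊆ᵇ P → (∀ w → T (Q w) → ¬ T (R w)) →
                count Q + count R ≤ count P
count-≤-split P Q R Q⊆P R⊆P disjoint =
  subst (_≤ count P) (∑-distrib-+ (𝟙 ∘ Q) (𝟙 ∘ R))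
        (∑-mono-≤ λ w → 𝟙-≤-split (Q⊆P w) (R⊆P w) (disjoint w))
  where
  𝟙-≤-split : ∀ {p q r} → (T q → T p) → (T r → T p) → (T q → ¬ T r) → 𝟙 q + 𝟙 r ≤ 𝟙 p
  𝟙-≤-split {false} {false} {false} _   _   _    = z≤n
  𝟙-≤-split {false} {false} {true}  _   r⇒p _    = ⊥-elim (r⇒p tt)
  𝟙-≤-split {false} {true}          q⇒p _   _    = ⊥-elim (q⇒p tt)
  𝟙-≤-split {true}  {false} {false} _   _   _    = z≤n
  𝟙-≤-split {true}  {false} {true}  _   _   _    = ≤-refl
  𝟙-≤-split {true}  {true}  {false} _   _   _    = ≤-refl
  𝟙-≤-split {true}  {true}  {true}  _   _   disj = ⊥-elim (disj tt tt)

count-split-by : (P Q : Fin n → Bool) →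
                 count Q ≡ count (λ w → P w ∧ Q w) + count (λ w → Q w ∧ not (P w))
count-split-by P Q = trans (sum-cong-≗ λ w → 𝟙-split-by (P w) (Q w))
                           (∑-distrib-+ (λ w → 𝟙 (P w ∧ Q w)) (λ w → 𝟙 (Q w ∧ not (P w))))
  where
  𝟙-split-by : ∀ p q → 𝟙 q ≡ 𝟙 (p ∧ q) + 𝟙 (q ∧ not p)
  𝟙-split-by true  true  = refl
  𝟙-split-by true  false = refl
  𝟙-split-by false true  = refl
  𝟙-split-by false false = refl

count-remove : (P : Fin n → Bool) (x : Fin n) → T (P x) → count P ≡ suc (count (P ∖ x))
count-remove P x px =
  trans (count-split P (_≡ᵇ x) (P ∖ x) cover x⊆P (λ w → proj₁ ∘ ∖-elim P) disjoint)
        (cong (_+ count (P ∖ x)) (count-≡ᵇ x))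
  where
  cover : ∀ w → T (P w) → T (w ≡ᵇ x) ⊎ T ((P ∖ x) w)
  cover w pw = map₂ (∖-intro P pw) (≡ᵇ⊎≢ w x)
  x⊆P : (_≡ᵇ x) ⊆ᵇ P
  x⊆P w t = subst (T ∘ P) (sym (toWitness t)) px
  disjoint : ∀ w → T (w ≡ᵇ x) → ¬ T ((P ∖ x) w)
  disjoint w t t′ = proj₂ (∖-elim P t′) (toWitness t)

distinct⇒length≤count : (P : Fin n → Bool) (xs : List (Fin n)) →
                        AllPairs _≢_ xs → All (T ∘ P) xs → length xs ≤ count P
distinct⇒length≤count P []       _              _          = z≤n
distinct⇒length≤count P (x ∷ xs) (x≢xs ∷ xs≢xs) (px ∷ pxs) rewrite count-remove P x px =
  s≤s (distinct⇒length≤count (P ∖ x) xs xs≢xs (removed x≢xs pxs))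
  where
  removed : ∀ {ys} → All (x ≢_) ys → All (T ∘ P) ys → All (T ∘ (P ∖ x)) ys
  removed []             []         = []
  removed (x≢y ∷ x≢ys)   (py ∷ pys) = ∖-intro P py (x≢y ∘ sym) ∷ removed x≢ys pys

1≤count⇒∃ : (P : Fin n → Bool) → 1 ≤ count P → ∃[ x ] T (P x)
1≤count⇒∃ {suc n} P 1≤c with P zero in eq
... | true  = zero , subst T (sym eq) tt
... | false = let x , px = 1≤count⇒∃ (P ∘ suc) 1≤c in suc x , px

2≤count⇒∃₂ : (P : Fin n → Bool) → 2 ≤ count P → ∃₂ λ x y → T (P x) × T (P y) × x ≢ y
2≤count⇒∃₂ P 2≤c =
  let x , px = 1≤count⇒∃ P (≤-trans (s≤s z≤n) 2≤c)
      y , py = 1≤count⇒∃ (P ∖ x) (≤-pred (subst (2 ≤_) (count-remove P x px) 2≤c))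
      py′ , y≢x = ∖-elim P py
  in x , y , px , py′ , y≢x ∘ sym

_·_ : Permutation′ n → Fin n → Fin n
g · x = g ⟨$⟩ʳ x

·-injective : (g : Permutation′ n) {x y : Fin n} → g · x ≡ g · y → x ≡ y
·-injective g = Injection.injective (↔⇒↣ g)

module _ {n : ℕ} (Γ : Digraph n) where

  infix 4 _⟶_
  _⟶_ : Fin n → Fin n → Set
  u ⟶ v = Arc Γ u v

  common⁺ common⁻ between : Fin n → Fin n → Fin n → Bool
  common⁺ x y w = adj Γ x w ∧ adj Γ y w
  common⁻ x y w = adj Γ w x ∧ adj Γ w y
  between x y w = adj Γ x w ∧ adj Γ w y

  IsTournament : Set
  IsTournament = ∀ u w → u ≢ w → u ⟶ w ⊎ w ⟶ u

  PairwiseAdjacent : (Fin n → Bool) → Set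
  PairwiseAdjacent Q = ∀ z z′ → T (Q z) → T (Q z′) → z ≢ z′ → z ⟶ z′ ⊎ z′ ⟶ z

  private variable
    s u v w x y z x′ y′ : Fin n
    F : Fin n → Fin n → Fin n → Bool

  ⟶-irrefl : ¬ x ⟶ x
  ⟶-irrefl = irrefl Γ _

  ⟶-asym : x ⟶ y → ¬ y ⟶ x
  ⟶-asym = antisym Γ _ _

  2-arc-distinct : x ⟶ y → y ⟶ z → x ≢ y × x ≢ z × y ≢ z
  2-arc-distinct xy yz = (λ { refl → ⟶-irrefl xy }) , (λ { refl → ⟶-asym xy yz })
                       , (λ { refl → ⟶-irrefl yz })

  2-arc⇒3≤count : T (Q x) → T (Q y) → T (Q z) → x ⟶ y → y ⟶ z → 3 ≤ count Q
  2-arc⇒3≤count {Q = Q} {x} {y} {z} qx qy qz xy yz =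
    let x≢y , x≢z , y≢z = 2-arc-distinct xy yz
    in distinct⇒length≤count Q (x ∷ y ∷ z ∷ [])
         ((x≢y ∷ x≢z ∷ []) ∷ (y≢z ∷ []) ∷ [] ∷ []) (qx ∷ qy ∷ qz ∷ [])

  PairwiseAdjacent-⊆ : Q ⊆ᵇ P → PairwiseAdjacent P → PairwiseAdjacent Q
  PairwiseAdjacent-⊆ Q⊆P adjacent z z′ qz qz′ = adjacent z z′ (Q⊆P z qz) (Q⊆P z′ qz′)

  count≤1⇒pairwise-adjacent : count Q ≤ 1 → PairwiseAdjacent Q
  count≤1⇒pairwise-adjacent {Q = Q} c≤1 z z′ qz qz′ z≢z′ = ⊥-elim (1+n≰n
    (≤-trans (distinct⇒length≤count Q (z ∷ z′ ∷ []) ((z≢z′ ∷ []) ∷ [] ∷ []) (qz ∷ qz′ ∷ [])) c≤1))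

  common⁺-between-⊆ : (P : Fin n → Bool) → T (P w) →
                      common⁺ v w ⊆ᵇ P → between v w ⊆ᵇ P →
                      suc (count (common⁺ v w) + count (between v w)) ≤ count P
  common⁺-between-⊆ {w} {v} P pw common⁺⊆P between⊆P = begin
    suc (count (common⁺ v w) + count (between v w))
      ≤⟨ s≤s (count-≤-split (P ∖ w) (common⁺ v w) (between v w)
                 (λ z t → ∖-intro P (common⁺⊆P z t) (w→z⇒z≢w (∧-proj₂ t)))
                 (λ z t → ∖-intro P (between⊆P z t) (z→w⇒z≢w (∧-proj₂ t)))
                 (λ z t t′ → ⟶-asym (∧-proj₂ t) (∧-proj₂ t′))) ⟩
    suc (count (P ∖ w))
      ≡⟨ count-remove P w pw ⟨
    count P ∎
    where
    open ≤-Reasoning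
    w→z⇒z≢w : w ⟶ z → z ≢ w
    w→z⇒z≢w wz refl = ⟶-irrefl wz
    z→w⇒z≢w : z ⟶ w → z ≢ w
    z→w⇒z≢w zw refl = ⟶-irrefl zw

  out-neighbourhood-≡ : v ⟶ w → (∀ z → v ⟶ z → z ≢ w → w ⟶ z ⊎ z ⟶ w) →
                        count (adj Γ v) ≡ suc (count (common⁺ v w) + count (between v w))
  out-neighbourhood-≡ {v} {w} vw adjacent-to-w =
    trans (count-remove (adj Γ v) w vw)
          (cong suc (count-split (adj Γ v ∖ w) (common⁺ v w) (between v w) cover
                       (λ z t → ∖-intro (adj Γ v) (∧-proj₁ t) (λ { refl → ⟶-irrefl (∧-proj₂ t) }))
                       (λ z t → ∖-intro (adj Γ v) (∧-proj₁ t) (λ { refl → ⟶-irrefl (∧-proj₂ t) }))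
                       (λ z t t′ → ⟶-asym (∧-proj₂ t) (∧-proj₂ t′))))
    where
    cover : ∀ z → T ((adj Γ v ∖ w) z) → T (common⁺ v w z) ⊎ T (between v w z)
    cover z t with vz , z≢w ← ∖-elim (adj Γ v) t with adjacent-to-w z vz z≢w
    ... | inj₁ wz = inj₁ (∧-intro vz wz)
    ... | inj₂ zw = inj₂ (∧-intro vz zw)

  -- Double counting transitive triangles

  arcSum : (Fin n → Fin n → Fin n → Bool) → ℕ
  arcSum F = sum λ x → sum λ y → 𝟙 (adj Γ x y) * count (F x y)

  arcCount : ℕ
  arcCount = sum λ x → count (adj Γ x)

  private
    ∑-scale : ∀ (c : ℕ) (f : Fin n → ℕ) → sum (λ i → c * f i) ≡ c * sum f
    ∑-scale c f = sym (*-distribˡ-sum c f)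

    𝟙-∧-swap : ∀ a b c → 𝟙 a * 𝟙 (b ∧ c) ≡ 𝟙 b * 𝟙 (a ∧ c)
    𝟙-∧-swap true  true  c = refl
    𝟙-∧-swap true  false c = refl
    𝟙-∧-swap false true  c = refl
    𝟙-∧-swap false false c = refl

    𝟙-∧-rotate : ∀ a b c → 𝟙 a * 𝟙 (b ∧ c) ≡ 𝟙 b * 𝟙 (c ∧ a)
    𝟙-∧-rotate true  true  true  = refl
    𝟙-∧-rotate true  true  false = refl
    𝟙-∧-rotate true  false c     = refl
    𝟙-∧-rotate false true  true  = refl
    𝟙-∧-rotate false true  false = refl
    𝟙-∧-rotate false false c     = refl

  arcSum-between≡arcSum-common⁺ : arcSum between ≡ arcSum common⁺
  arcSum-between≡arcSum-common⁺ = begin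
    sum (λ x → sum (λ y → 𝟙 (adj Γ x y) * count (between x y)))
      ≡⟨ sum-cong-≗ (λ x → sum-cong-≗ λ y → ∑-scale (𝟙 (adj Γ x y)) (𝟙 ∘ between x y)) ⟨
    sum (λ x → sum (λ y → sum (λ w → 𝟙 (adj Γ x y) * 𝟙 (adj Γ x w ∧ adj Γ w y))))
      ≡⟨ sum-cong-≗ (λ x → ∑-comm λ y w → 𝟙 (adj Γ x y) * 𝟙 (adj Γ x w ∧ adj Γ w y)) ⟩
    sum (λ x → sum (λ w → sum (λ y → 𝟙 (adj Γ x y) * 𝟙 (adj Γ x w ∧ adj Γ w y))))
      ≡⟨ sum-cong-≗ (λ x → sum-cong-≗ λ w → sum-cong-≗ λ y →
                      𝟙-∧-swap (adj Γ x y) (adj Γ x w) (adj Γ w y)) ⟩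
    sum (λ x → sum (λ w → sum (λ y → 𝟙 (adj Γ x w) * 𝟙 (adj Γ x y ∧ adj Γ w y))))
      ≡⟨ sum-cong-≗ (λ x → sum-cong-≗ λ w → ∑-scale (𝟙 (adj Γ x w)) (𝟙 ∘ common⁺ x w)) ⟩
    sum (λ x → sum (λ w → 𝟙 (adj Γ x w) * count (common⁺ x w))) ∎
    where open ≡-Reasoning

  arcSum-common⁻≡arcSum-common⁺ : arcSum common⁻ ≡ arcSum common⁺
  arcSum-common⁻≡arcSum-common⁺ = begin
    sum (λ x → sum (λ y → 𝟙 (adj Γ x y) * count (common⁻ x y)))
      ≡⟨ sum-cong-≗ (λ x → sum-cong-≗ λ y → ∑-scale (𝟙 (adj Γ x y)) (𝟙 ∘ common⁻ x y)) ⟨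
    sum (λ x → sum (λ y → sum (λ w → 𝟙 (adj Γ x y) * 𝟙 (adj Γ w x ∧ adj Γ w y))))
      ≡⟨ sum-cong-≗ (λ x → ∑-comm λ y w → 𝟙 (adj Γ x y) * 𝟙 (adj Γ w x ∧ adj Γ w y)) ⟩
    sum (λ x → sum (λ w → sum (λ y → 𝟙 (adj Γ x y) * 𝟙 (adj Γ w x ∧ adj Γ w y))))
      ≡⟨ ∑-comm (λ x w → sum λ y → 𝟙 (adj Γ x y) * 𝟙 (adj Γ w x ∧ adj Γ w y)) ⟩
    sum (λ w → sum (λ x → sum (λ y → 𝟙 (adj Γ x y) * 𝟙 (adj Γ w x ∧ adj Γ w y))))
      ≡⟨ sum-cong-≗ (λ w → sum-cong-≗ λ x → sum-cong-≗ λ y →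
                      𝟙-∧-rotate (adj Γ x y) (adj Γ w x) (adj Γ w y)) ⟩
    sum (λ w → sum (λ x → sum (λ y → 𝟙 (adj Γ w x) * 𝟙 (adj Γ w y ∧ adj Γ x y))))
      ≡⟨ sum-cong-≗ (λ w → sum-cong-≗ λ x → ∑-scale (𝟙 (adj Γ w x)) (𝟙 ∘ common⁺ w x)) ⟩
    sum (λ w → sum (λ x → 𝟙 (adj Γ w x) * count (common⁺ w x))) ∎
    where open ≡-Reasoning

  arcSum-constant : ∀ {c} → (∀ {x y} → x ⟶ y → count (F x y) ≡ c) → arcSum F ≡ arcCount * c
  arcSum-constant {F} {c} constant = begin
    sum (λ x → sum (λ y → 𝟙 (adj Γ x y) * count (F x y)))
      ≡⟨ sum-cong-≗ (λ x → sum-cong-≗ λ y → 𝟙-*-cong (adj Γ x y) constant) ⟩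
    sum (λ x → sum (λ y → 𝟙 (adj Γ x y) * c))
      ≡⟨ sum-cong-≗ (λ x → *-distribʳ-sum c (𝟙 ∘ adj Γ x)) ⟨
    sum (λ x → count (adj Γ x) * c)
      ≡⟨ *-distribʳ-sum c (λ x → count (adj Γ x)) ⟨
    arcCount * c ∎
    where
    open ≡-Reasoning
    𝟙-*-cong : ∀ b {m} → (T b → m ≡ c) → 𝟙 b * m ≡ 𝟙 b * c
    𝟙-*-cong true  m≡c = cong (_+ 0) (m≡c tt)
    𝟙-*-cong false _   = refl

  arcCount-positive : x ⟶ y → 1 ≤ arcCount
  arcCount-positive {x} {y} xy = begin
    1                    ≤⟨ distinct⇒length≤count (adj Γ x) (y ∷ []) ([] ∷ []) (xy ∷ []) ⟩
    count (adj Γ x)      ≤⟨ term≤∑ (λ x → count (adj Γ x)) x ⟩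
    arcCount             ∎
    where open ≤-Reasoning

  arc-constants-agree : ∀ {F F′ c c′} → x ⟶ y →
                        (∀ {x y} → x ⟶ y → count (F x y) ≡ c) →
                        (∀ {x y} → x ⟶ y → count (F′ x y) ≡ c′) →
                        arcSum F ≡ arcSum F′ → c ≡ c′
  arc-constants-agree {c = c} {c′} xy constant constant′ same =
    *-cancelˡ-≡ c c′ arcCount {{>-nonZero (arcCount-positive xy)}}
      (trans (sym (arcSum-constant constant)) (trans same (arcSum-constant constant′)))

  walk₀⇒≡ : Walk Γ 0 u w → u ≡ w
  walk₀⇒≡ here = refl

  walk₁⇒arc : Walk Γ 1 u w → u ⟶ w
  walk₁⇒arc (step uw here) = uw

  walk₂⇒2-arc : Walk Γ 2 u w → ∃[ p ] (u ⟶ p × p ⟶ w)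
  walk₂⇒2-arc (step up (step pw here)) = _ , up , pw

  2-arc⇒dist₂ : u ⟶ v → v ⟶ w → ¬ u ⟶ w → Dist Γ u w 2
  2-arc⇒dist₂ uv vw ¬uw = step uv (step vw here) , shorter
    where
    shorter : ∀ k → k ℕ.< 2 → ¬ Walk Γ k _ _
    shorter zero          _                 walk = ⟶-asym uv (subst (_ ⟶_) (sym (walk₀⇒≡ walk)) vw)
    shorter (suc zero)    _                 walk = ¬uw (walk₁⇒arc walk)
    shorter (suc (suc _)) (s≤s (s≤s ()))    _

  dist≤2-cases : ∃[ d ] (d ≤ 2 × Dist Γ u w d) → u ≡ w ⊎ u ⟶ w ⊎ Dist Γ u w 2
  dist≤2-cases (0 , _ , walk , _)     = inj₁ (walk₀⇒≡ walk)
  dist≤2-cases (1 , _ , walk , _)     = inj₂ (inj₁ (walk₁⇒arc walk))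
  dist≤2-cases (2 , _ , d)            = inj₂ (inj₂ d)
  dist≤2-cases (suc (suc (suc _)) , s≤s (s≤s ()) , _)

  in-neighbour⇒dist₂ : (∀ u v → ∃[ d ] (d ≤ 2 × Dist Γ u v d)) → z ⟶ u → Dist Γ u z 2
  in-neighbour⇒dist₂ {z} {u} within zu with dist≤2-cases (within u z)
  ... | inj₁ refl       = ⊥-elim (⟶-irrefl zu)
  ... | inj₂ (inj₁ uz)  = ⊥-elim (⟶-asym uz zu)
  ... | inj₂ (inj₂ d)   = d

  diameter-2⇒arc : HasDiameter Γ 2 → ∃₂ _⟶_
  diameter-2⇒arc (_ , u , _ , walk , _) = let p , up , _ = walk₂⇒2-arc walk in u , p , up

  aut-arc : ∀ g → IsAut Γ g → x ⟶ y → g · x ⟶ g · y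
  aut-arc {x} {y} g aut = subst T (sym (aut x y))

  aut-cannot-swap : ∀ g → IsAut Γ g → g · (g · z) ≡ z → ¬ (z ⟶ g · z ⊎ g · z ⟶ z)
  aut-cannot-swap {z} g aut swap =
    [ no-arc , no-arc ∘ subst (_⟶ g · z) swap ∘ aut-arc g aut ]
    where
    no-arc : ¬ z ⟶ g · z
    no-arc zgz = ⟶-asym zgz (subst (g · z ⟶_) swap (aut-arc g aut zgz))

  -- An automorphism preserving a pairwise adjacent set of at most two vertices cannot
  -- swap two of them (that would reverse an arc), so it fixes the set pointwise.
  aut-fixes-small-tournament : ∀ g → IsAut Γ g → count Q ≤ 2 →
                               (∀ z → T (Q z) → T (Q (g · z))) →
                               PairwiseAdjacent Q → T (Q z) → g · z ≡ z
  aut-fixes-small-tournament {Q = Q} {z = z} g aut Q≤2 preserved adjacent qz with g · z ≟ z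
  ... | yes fixed = fixed
  ... | no  moved with g · (g · z) ≟ z
  ...   | yes swap =
    ⊥-elim (aut-cannot-swap g aut swap (adjacent z (g · z) qz (preserved z qz) (moved ∘ sym)))
  ...   | no  no-swap = ⊥-elim (1+n≰n (≤-trans three≤count Q≤2))
    where
    three≤count : 3 ≤ count Q
    three≤count = distinct⇒length≤count Q (z ∷ g · z ∷ g · (g · z) ∷ [])
      (((moved ∘ sym) ∷ (no-swap ∘ sym) ∷ []) ∷ ((moved ∘ sym ∘ ·-injective g) ∷ []) ∷ [] ∷ [])
      (qz ∷ preserved z qz ∷ preserved (g · z) (preserved z qz) ∷ [])

  Invariant : (Fin n → Fin n → Fin n → Bool) → Set
  Invariant F = ∀ g → IsAut Γ g → ∀ x y w → F (g · x) (g · y) (g · w) ≡ F x y w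

  out-invariant : Invariant (λ x _ w → adj Γ x w)
  out-invariant g aut x y w = aut x w

  common⁺-invariant : Invariant common⁺
  common⁺-invariant g aut x y w = cong₂ _∧_ (aut x w) (aut y w)

  common⁻-invariant : Invariant common⁻
  common⁻-invariant g aut x y w = cong₂ _∧_ (aut w x) (aut w y)

  between-invariant : Invariant between
  between-invariant g aut x y w = cong₂ _∧_ (aut x w) (aut w y)

  count-invariant : ∀ g → Invariant F → IsAut Γ g → count (F (g · x) (g · y)) ≡ count (F x y)
  count-invariant {F} {x} {y} g inv aut =
    trans (sym (count-permute g (F (g · x) (g · y)))) (count-cong (inv g aut x y))

  stabiliser-preserves : ∀ g → Invariant F → IsAut Γ g → g · x ≡ x → g · y ≡ y →
                         ∀ z → T (F x y z) → T (F x y (g · z))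
  stabiliser-preserves {F} {x} {y} g inv aut gx gy z =
    subst T (trans (sym (inv g aut x y z)) (cong₂ (λ p q → F p q (g · z)) gx gy))

  module _ (G : SubgroupOfAut Γ) where

    vertex-transitive : ArcTransitive G → ∀ x x′ → ∃[ g ] (member G g × g · x ≡ x′)
    vertex-transitive (vt , _) x x′ =
      let g , g∈G , e = vt (x ∷ []) (x′ ∷ []) tt tt in g , g∈G , proj₁ (∷-injective e)

    arc-transitive : ArcTransitive G → x ⟶ y → x′ ⟶ y′ →
                     ∃[ g ] (member G g × g · x ≡ x′ × g · y ≡ y′)
    arc-transitive {x} {y} {x′} {y′} (_ , at) xy x′y′ =
      let g , g∈G , e = at (x ∷ y ∷ []) (x′ ∷ y′ ∷ []) (xy , tt) (x′y′ , tt)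
          gx , e′ = ∷-injective e
      in g , g∈G , gx , proj₁ (∷-injective e′)

    2-geodesic-transitive : GeodesicTransitive G 2 →
                            IsGeodesic Γ 2 (x ∷ y ∷ z ∷ []) → IsGeodesic Γ 2 (x′ ∷ y′ ∷ w ∷ []) →
                            ∃[ g ] (member G g × g · x ≡ x′ × g · y ≡ y′ × g · z ≡ w)
    2-geodesic-transitive gt geo geo′ =
      let g , g∈G , e = gt 2 ≤-refl _ _ geo geo′
          gx , e′ = ∷-injective e
          gy , e″ = ∷-injective e′
      in g , g∈G , gx , gy , proj₁ (∷-injective e″)

    dist₂-transitive : GeodesicTransitive G 2 → Dist Γ u w 2 → Dist Γ x y 2 →
                       ∃[ g ] (member G g × g · u ≡ x × g · w ≡ y)
    dist₂-transitive gt d d′ =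
      let _ , up , pw = walk₂⇒2-arc (proj₁ d)
          _ , xq , qy = walk₂⇒2-arc (proj₁ d′)
          g , g∈G , gu , _ , gw =
            2-geodesic-transitive gt ((up , pw , tt) , d) ((xq , qy , tt) , d′)
      in g , g∈G , gu , gw

    2-arc-transitive⇒2-geodesic-transitive : ArcTransitive G → TwoArcTransitive G →
                                              GeodesicTransitive G 2
    2-arc-transitive⇒2-geodesic-transitive (vt , _) _ zero _ x y _ _ = vt x y tt tt
    2-arc-transitive⇒2-geodesic-transitive (_ , at) _ 1 _ x y (x-arc , _) (y-arc , _) =
      at x y x-arc y-arc
    2-arc-transitive⇒2-geodesic-transitive _ tat 2 _ x y (x-2arc , _) (y-2arc , _) =
      tat x y x-2arc y-2arc
    2-arc-transitive⇒2-geodesic-transitive _ _ (suc (suc (suc _))) (s≤s (s≤s ()))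

    module ArcTransitiveCounts (at : ArcTransitive G) where

      count-constant-on-arcs : Invariant F → x ⟶ y → x′ ⟶ y′ → count (F x y) ≡ count (F x′ y′)
      count-constant-on-arcs inv xy x′y′ with arc-transitive at xy x′y′
      ... | g , g∈G , refl , refl = sym (count-invariant g inv (⊆Aut G g∈G))

      outDegree-constant : ∀ x x′ → count (adj Γ x) ≡ count (adj Γ x′)
      outDegree-constant x x′ with vertex-transitive at x x′
      ... | g , g∈G , refl = sym (count-invariant {y = x} g out-invariant (⊆Aut G g∈G))

      between≡common⁺ : x ⟶ y → x′ ⟶ y′ → count (between x y) ≡ count (common⁺ x′ y′)
      between≡common⁺ xy x′y′ =
        arc-constants-agree xy (λ b → count-constant-on-arcs between-invariant b xy)
                               (λ b → count-constant-on-arcs common⁺-invariant b x′y′)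
                               arcSum-between≡arcSum-common⁺

      common⁻≡common⁺ : x ⟶ y → x′ ⟶ y′ → count (common⁻ x y) ≡ count (common⁺ x′ y′)
      common⁻≡common⁺ xy x′y′ =
        arc-constants-agree xy (λ b → count-constant-on-arcs common⁻-invariant b xy)
                               (λ b → count-constant-on-arcs common⁺-invariant b x′y′)
                               arcSum-common⁻≡arcSum-common⁺

    -- Part (ii)

    has-in-neighbour : ArcTransitive G → ∃₂ _⟶_ → ∀ u → ∃[ z ] z ⟶ u
    has-in-neighbour at (x , y , xy) u =
      let g , g∈G , gy≡u = vertex-transitive at y u
      in g · x , subst (g · x ⟶_) gy≡u (aut-arc g (⊆Aut G g∈G) xy)

    diameter-2⇒tournament : ArcTransitive G → GeodesicTransitive G 2 → HasDiameter Γ 2 →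
                            IsTournament
    diameter-2⇒tournament at gt diam@(within , _) u w u≢w
      with has-in-neighbour at (diameter-2⇒arc diam) u | dist≤2-cases (within u w)
    ... | _ , _  | inj₁ u≡w        = ⊥-elim (u≢w u≡w)
    ... | _ , _  | inj₂ (inj₁ uw)  = inj₁ uw
    ... | z , zu | inj₂ (inj₂ d)
      with h , h∈G , hu , hz ← dist₂-transitive gt (in-neighbour⇒dist₂ within zu) d
      = inj₂ (subst₂ _⟶_ hz hu (aut-arc h (⊆Aut G h∈G) zu))

    module TournamentCounts (at : ArcTransitive G) (tournament : IsTournament)
                            {x₀ y₀} (x₀y₀ : x₀ ⟶ y₀) where
      open ArcTransitiveCounts at

      a outdegree indegree e : ℕ
      a         = count (common⁺ x₀ y₀)
      outdegree = count (adj Γ x₀)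
      indegree  = count (λ w → adj Γ w x₀)
      e         = count (between y₀ x₀)

      outdegree≡ : outdegree ≡ suc (a + a)
      outdegree≡ = trans (out-neighbourhood-≡ x₀y₀ λ z _ z≢y₀ → tournament y₀ z (z≢y₀ ∘ sym))
                         (cong (λ b → suc (a + b)) (between≡common⁺ x₀y₀ x₀y₀))

      out-y₀≡ : count (adj Γ y₀) ≡ a + e
      out-y₀≡ = count-split (adj Γ y₀) (common⁺ x₀ y₀) (between y₀ x₀) cover
                  (λ _ → ∧-proj₂) (λ _ → ∧-proj₁) (λ _ t t′ → ⟶-asym (∧-proj₁ t) (∧-proj₂ t′))
        where
        cover : ∀ z → y₀ ⟶ z → T (common⁺ x₀ y₀ z) ⊎ T (between y₀ x₀ z)
        cover z y₀z with tournament x₀ z (λ { refl → ⟶-asym x₀y₀ y₀z })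
        ... | inj₁ x₀z = inj₁ (∧-intro x₀z y₀z)
        ... | inj₂ zx₀ = inj₂ (∧-intro y₀z zx₀)

      e≡ : e ≡ suc a
      e≡ = +-cancelˡ-≡ a e (suc a) (begin
        a + e            ≡⟨ out-y₀≡ ⟨
        count (adj Γ y₀) ≡⟨ outDegree-constant y₀ x₀ ⟩
        outdegree        ≡⟨ outdegree≡ ⟩
        suc (a + a)      ≡⟨ +-suc a a ⟨
        a + suc a        ∎)
        where open ≡-Reasoning

      in-x₀≡ : indegree ≡ count (common⁻ x₀ y₀) + e
      in-x₀≡ = count-split (λ w → adj Γ w x₀) (common⁻ x₀ y₀) (between y₀ x₀) cover
                 (λ _ → ∧-proj₁) (λ _ → ∧-proj₂) (λ _ t t′ → ⟶-asym (∧-proj₂ t) (∧-proj₁ t′))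
        where
        cover : ∀ z → z ⟶ x₀ → T (common⁻ x₀ y₀ z) ⊎ T (between y₀ x₀ z)
        cover z zx₀ with tournament z y₀ (λ { refl → ⟶-asym x₀y₀ zx₀ })
        ... | inj₁ zy₀ = inj₁ (∧-intro zx₀ zy₀)
        ... | inj₂ y₀z = inj₂ (∧-intro y₀z zx₀)

      order≡ : n ≡ suc (outdegree + indegree)
      order≡ = begin
        n                           ≡⟨ count-true n ⟨
        count vertices              ≡⟨ count-remove vertices x₀ tt ⟩
        suc (count (vertices ∖ x₀))
          ≡⟨ cong suc (count-split (vertices ∖ x₀) (adj Γ x₀) (λ w → adj Γ w x₀) cover
                         (λ _ t → ∖-intro vertices tt (λ { refl → ⟶-irrefl t }))
                         (λ _ t → ∖-intro vertices tt (λ { refl → ⟶-irrefl t }))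
                         (λ _ → ⟶-asym)) ⟩
        suc (outdegree + indegree)  ∎
        where
        open ≡-Reasoning
        vertices : Fin n → Bool
        vertices _ = true
        cover : ∀ z → T ((vertices ∖ x₀) z) → x₀ ⟶ z ⊎ z ⟶ x₀
        cover z t = tournament x₀ z (proj₂ (∖-elim vertices t) ∘ sym)

      common⁻≡a : ∀ x y → x ≢ y → count (common⁻ x y) ≡ a
      common⁻≡a x y x≢y with tournament x y x≢y
      ... | inj₁ xy = common⁻≡common⁺ xy x₀y₀
      ... | inj₂ yx = trans (count-cong λ w → ∧-comm (adj Γ w x) (adj Γ w y))
                            (common⁻≡common⁺ yx x₀y₀)

      hadamard : HadamardDesign Γ
      hadamard = suc a , s≤s z≤n , order , valency , λ x y x≢y → begin
          length (filterᵇ (common⁻ x y) (allFin n)) + 1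
            ≡⟨ cong (_+ 1) (trans (length-filterᵇ-tabulate (common⁻ x y) id) (common⁻≡a x y x≢y)) ⟩
          a + 1 ≡⟨ +-comm a 1 ⟩
          suc a ∎
        where
        open ≡-Reasoning
        open +-*-Solver
        order : n + 1 ≡ 4 * suc a
        order = begin
          n + 1 ≡⟨ cong (_+ 1) order≡ ⟩
          suc (outdegree + indegree) + 1
            ≡⟨ cong (λ m → suc m + 1) (cong₂ _+_ outdegree≡
                 (trans in-x₀≡ (cong₂ _+_ (common⁻≡common⁺ x₀y₀ x₀y₀) e≡))) ⟩
          suc (suc (a + a) + (a + suc a)) + 1
            ≡⟨ solve 1 (λ a → (con 1 :+ ((con 1 :+ (a :+ a)) :+ (a :+ (con 1 :+ a)))) :+ con 1
                              := con 4 :* (con 1 :+ a)) refl a ⟩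
          4 * suc a ∎
        valency : ∀ v → outDeg Γ v + 1 ≡ 2 * suc a
        valency v = begin
          outDeg Γ v + 1      ≡⟨ cong (_+ 1) (length-filterᵇ-tabulate (adj Γ v) id) ⟩
          count (adj Γ v) + 1 ≡⟨ cong (_+ 1) (trans (outDegree-constant v x₀) outdegree≡) ⟩
          suc (a + a) + 1
            ≡⟨ solve 1 (λ a → (con 1 :+ (a :+ a)) :+ con 1 := con 2 :* (con 1 :+ a)) refl a ⟩
          2 * suc a           ∎

    -- Part (i)

    module TriangleFree (at : ArcTransitive G) (gt : GeodesicTransitive G 2)
                        (valency≤5 : ∀ v → outDeg Γ v ≤ 5)
                        {u v w} (uv : u ⟶ v) (vw : v ⟶ w) (uw : u ⟶ w) where
      open ArcTransitiveCounts at

      a : ℕ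
      a = count (common⁺ u v)

      common⁺≡a : x ⟶ y → count (common⁺ x y) ≡ a
      common⁺≡a xy = count-constant-on-arcs common⁺-invariant xy uv

      between≡a : x ⟶ y → count (between x y) ≡ a
      between≡a xy = between≡common⁺ xy uv

      valency-v≤5 : count (adj Γ v) ≤ 5
      valency-v≤5 = subst (_≤ 5) (length-filterᵇ-tabulate (adj Γ v) id) (valency≤5 v)

      ¬6≤valency : ¬ 6 ≤ count (adj Γ v)
      ¬6≤valency = ≤⇒≯ valency-v≤5

      1+2a≤valency : suc (a + a) ≤ count (adj Γ v)
      1+2a≤valency = subst (_≤ count (adj Γ v))
                           (cong₂ (λ p q → suc (p + q)) (common⁺≡a vw) (between≡a vw))
                           (common⁺-between-⊆ (adj Γ v) vw (λ _ → ∧-proj₁) (λ _ → ∧-proj₁))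

      1≤a : 1 ≤ a
      1≤a = distinct⇒length≤count (common⁺ u v) (w ∷ []) ([] ∷ []) (∧-intro uw vw ∷ [])

      a≡1⊎a≡2 : a ≡ 1 ⊎ a ≡ 2
      a≡1⊎a≡2 = small a 1≤a (≤-trans 1+2a≤valency valency-v≤5)
        where
        small : ∀ m → 1 ≤ m → suc (m + m) ≤ 5 → m ≡ 1 ⊎ m ≡ 2
        small 1 _ _ = inj₁ refl
        small 2 _ _ = inj₂ refl
        small (suc (suc (suc m))) _ (s≤s (s≤s (s≤s (s≤s m+3+m≤1)))) =
          ⊥-elim (≤⇒≯ m+3+m≤1 (≤-trans (s≤s (s≤s z≤n)) (m≤n+m _ m)))

      a≤2 : a ≤ 2
      a≤2 = [ (λ a≡1 → subst (_≤ 2) (sym a≡1) (s≤s z≤n))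
            , (λ a≡2 → subst (_≤ 2) (sym a≡2) ≤-refl) ]′ a≡1⊎a≡2

      -- If a = 2 then Γ⁺(v) is a tournament: a non-adjacent pair z, z′ would give the
      -- six distinct out-neighbours z, z′, Γ⁺(v) ∩ Γ⁺(z) and Γ⁺(v) ∩ Γ⁻(z).
      a≡2⇒out-neighbours-adjacent : a ≡ 2 → PairwiseAdjacent (adj Γ v)
      a≡2⇒out-neighbours-adjacent a≡2 z z′ vz vz′ z≢z′ with T? (adj Γ z z′) | T? (adj Γ z′ z)
      ... | yes zz′ | _        = inj₁ zz′
      ... | no _    | yes z′z  = inj₂ z′z
      ... | no ¬zz′ | no ¬z′z  = ⊥-elim (¬6≤valency (begin
        6
          ≡⟨ cong (λ b → suc (suc (b + b))) a≡2 ⟨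
        suc (suc (a + a))
          ≡⟨ cong₂ (λ p q → suc (suc (p + q))) (common⁺≡a vz) (between≡a vz) ⟨
        suc (suc (count (common⁺ v z) + count (between v z)))
          ≤⟨ s≤s (common⁺-between-⊆ (adj Γ v ∖ z′) (∖-intro (adj Γ v) vz z≢z′)
                   (λ _ t → ∖-intro (adj Γ v) (∧-proj₁ t) λ { refl → ¬zz′ (∧-proj₂ t) })
                   (λ _ t → ∖-intro (adj Γ v) (∧-proj₁ t) λ { refl → ¬z′z (∧-proj₂ t) })) ⟩
        suc (count (adj Γ v ∖ z′))
          ≡⟨ count-remove (adj Γ v) z′ vz′ ⟨
        count (adj Γ v) ∎))
        where open ≤-Reasoning

      module Stabiliser {g} (g∈G : member G g) (gu : g · u ≡ u) (gv : g · v ≡ v) where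

        aut : IsAut Γ g
        aut = ⊆Aut G g∈G

        fixes-block : Invariant F → g · x ≡ x → g · y ≡ y → count (F x y) ≡ a →
                      PairwiseAdjacent (F x y) → T (F x y z) → g · z ≡ z
        fixes-block inv gx gy c adjacent =
          aut-fixes-small-tournament g aut (subst (_≤ 2) (sym c) a≤2)
            (stabiliser-preserves g inv aut gx gy) adjacent

        module A≡2 (a≡2 : a ≡ 2) where

          inside-Γ⁺v : Q ⊆ᵇ adj Γ v → PairwiseAdjacent Q
          inside-Γ⁺v Q⊆ = PairwiseAdjacent-⊆ Q⊆ (a≡2⇒out-neighbours-adjacent a≡2)

          gw : g · w ≡ w
          gw = fixes-block common⁺-invariant gu gv refl (inside-Γ⁺v (λ _ → ∧-proj₂)) (∧-intro uw vw)

          fixes-out-neighbours : v ⟶ y → g · y ≡ y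
          fixes-out-neighbours {y} vy with y ≟ w
          ... | yes refl = gw
          ... | no y≢w with a≡2⇒out-neighbours-adjacent a≡2 w y vw vy (y≢w ∘ sym)
          ...   | inj₁ wy = fixes-block common⁺-invariant gv gw (common⁺≡a vw)
                              (inside-Γ⁺v (λ _ → ∧-proj₁)) (∧-intro vy wy)
          ...   | inj₂ yw = fixes-block between-invariant gv gw (between≡a vw)
                              (inside-Γ⁺v (λ _ → ∧-proj₁)) (∧-intro vy yw)

        Fixed Moved : Fin n → Bool
        Fixed z = ⌊ g · z ≟ z ⌋ ∧ adj Γ v z
        Moved z = adj Γ v z ∧ not ⌊ g · z ≟ z ⌋

        Fixed-intro : g · z ≡ z → v ⟶ z → T (Fixed z)
        Fixed-intro {z} gz vz = ∧-intro {⌊ g · z ≟ z ⌋} (fromWitness gz) vz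

        Fixed-elim : T (Fixed z) → g · z ≡ z × v ⟶ z
        Fixed-elim {z} t = toWitness (∧-proj₁ {⌊ g · z ≟ z ⌋} t) , ∧-proj₂ {⌊ g · z ≟ z ⌋} t

        Moved-intro : v ⟶ z → g · z ≢ z → T (Moved z)
        Moved-intro {z} vz gz≢z = ∧-intro {adj Γ v z} vz (fromWitnessFalse gz≢z)

        Moved-elim : T (Moved z) → v ⟶ z × g · z ≢ z
        Moved-elim {z} t = ∧-proj₁ {adj Γ v z} t , toWitnessFalse (∧-proj₂ {adj Γ v z} t)

        -- If a = 1, the fixed out-neighbours of v are closed under successors and the moved
        -- ones under predecessors inside Γ⁺(v); both sets then contain a 2-arc.
        module A≡1 (a≡1 : a ≡ 1) where

          singleton : count Q ≡ a → PairwiseAdjacent Q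
          singleton c = count≤1⇒pairwise-adjacent (subst (_≤ 1) (sym (trans c a≡1)) ≤-refl)

          fixes-successor : v ⟶ x → g · x ≡ x → v ⟶ s → x ⟶ s → g · s ≡ s
          fixes-successor vx gx vs xs =
            fixes-block common⁺-invariant gv gx (common⁺≡a vx) (singleton (common⁺≡a vx))
              (∧-intro vs xs)

          fixed-successor : T (Fixed x) → ∃[ s ] (T (Fixed s) × x ⟶ s)
          fixed-successor t =
            let gx , vx = Fixed-elim t
                s , vs∧xs = 1≤count⇒∃ (common⁺ v _) (subst (1 ≤_) (sym (common⁺≡a vx)) 1≤a)
                vs = ∧-proj₁ vs∧xs
                xs = ∧-proj₂ vs∧xs
            in s , Fixed-intro (fixes-successor vx gx vs xs) vs , xs

          moved-predecessor : T (Moved x) → ∃[ p ] (T (Moved p) × p ⟶ x)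
          moved-predecessor t =
            let vx , gx≢x = Moved-elim t
                p , vp∧px = 1≤count⇒∃ (between v _) (subst (1 ≤_) (sym (between≡a vx)) 1≤a)
                vp = ∧-proj₁ vp∧px
                px = ∧-proj₂ vp∧px
            in p , Moved-intro vp (λ gp → gx≢x (fixes-successor vp gp vx px)) , px

          3≤count-Fixed : 3 ≤ count Fixed
          3≤count-Fixed =
            let gw = fixes-block common⁺-invariant gu gv refl (singleton refl) (∧-intro uw vw)
                fw = Fixed-intro gw vw
                s₁ , f₁ , ws₁ = fixed-successor fw
                s₂ , f₂ , s₁s₂ = fixed-successor f₁
            in 2-arc⇒3≤count {Q = Fixed} fw f₁ f₂ ws₁ s₁s₂

          3≤count-Moved : T (Moved y) → 3 ≤ count Moved
          3≤count-Moved my =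
            let p₁ , m₁ , p₁y = moved-predecessor my
                p₂ , m₂ , p₂p₁ = moved-predecessor m₁
            in 2-arc⇒3≤count {Q = Moved} m₂ m₁ my p₂p₁ p₁y

          fixes-out-neighbours : v ⟶ y → g · y ≡ y
          fixes-out-neighbours {y} vy with g · y ≟ y
          ... | yes gy    = gy
          ... | no  moved = ⊥-elim (¬6≤valency (begin
            6                           ≤⟨ +-mono-≤ 3≤count-Fixed
                                             (3≤count-Moved (Moved-intro vy moved)) ⟩
            count Fixed + count Moved   ≡⟨ count-split-by (λ z → ⌊ g · z ≟ z ⌋) (adj Γ v) ⟨
            count (adj Γ v)             ∎))
            where open ≤-Reasoning

        fixes-out-neighbours : v ⟶ y → g · y ≡ y
        fixes-out-neighbours vy = [ (λ a≡1 → A≡1.fixes-out-neighbours a≡1 vy)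
                                  , (λ a≡2 → A≡2.fixes-out-neighbours a≡2 vy) ]′ a≡1⊎a≡2

      -- Γ⁺(v) ∖ Γ⁺(u) has at least a + 1 ≥ 2 elements, each at distance 2 from u, so some
      -- element of G fixing u and v moves an out-neighbour of v.
      impossible : ⊥
      impossible =
        let z₁ , z₂ , b₁ , b₂ , z₁≢z₂ = 2≤count⇒∃₂ B 2≤count-B
            geodesic : ∀ {z} → T (B z) → IsGeodesic Γ 2 (u ∷ v ∷ z ∷ [])
            geodesic b = (uv , ∧-proj₁ b , tt) , 2-arc⇒dist₂ uv (∧-proj₁ b) (not-elim (∧-proj₂ b))
            g , g∈G , gu , gv , gz₁ = 2-geodesic-transitive gt (geodesic b₁) (geodesic b₂)
        in z₁≢z₂ (trans (sym (Stabiliser.fixes-out-neighbours g∈G gu gv (∧-proj₁ b₁))) gz₁)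
        where
        B : Fin n → Bool
        B z = adj Γ v z ∧ not (adj Γ u z)
        not-elim : ∀ {b} → T (not b) → ¬ T b
        not-elim {true} () _
        2≤count-B : 2 ≤ count B
        2≤count-B = ≤-trans (s≤s 1≤a) (+-cancelˡ-≤ a _ _ (begin
          a + suc a                  ≡⟨ +-suc a a ⟩
          suc (a + a)                ≤⟨ 1+2a≤valency ⟩
          count (adj Γ v)            ≡⟨ count-split-by (adj Γ u) (adj Γ v) ⟩
          a + count B                ∎))
          where open ≤-Reasoning

    2-geodesic-transitive⇒2-arc-transitive : ArcTransitive G → (∀ v → outDeg Γ v ≤ 5) →
                                              GeodesicTransitive G 2 → TwoArcTransitive G
    2-geodesic-transitive⇒2-arc-transitive at valency≤5 gt
      (x ∷ y ∷ z ∷ []) (x′ ∷ y′ ∷ z′ ∷ []) (xy , yz , _) (x′y′ , y′z′ , _) =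
      gt 2 ≤-refl _ _ (geodesic xy yz) (geodesic x′y′ y′z′)
      where
      geodesic : ∀ {x y z} → x ⟶ y → y ⟶ z → IsGeodesic Γ 2 (x ∷ y ∷ z ∷ [])
      geodesic xy yz =
        (xy , yz , tt) , 2-arc⇒dist₂ xy yz (TriangleFree.impossible at gt valency≤5 xy yz)

theorem1p5 : ∀ {n : ℕ} (Γ : Digraph n) (G : SubgroupOfAut Γ) → ArcTransitive G →
    ((∀ v → outDeg Γ v ≤ 5) → (GeodesicTransitive G 2 ⇔ TwoArcTransitive G))
    × ((GeodesicTransitive G 2 × HasDiameter Γ 2) → HadamardDesign Γ)
theorem1p5 Γ G at =
  (λ valency≤5 → mk⇔ (2-geodesic-transitive⇒2-arc-transitive Γ G at valency≤5)
                     (2-arc-transitive⇒2-geodesic-transitive Γ G at)) ,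
  λ (gt , diam) → let _ , _ , arc = diameter-2⇒arc Γ diam in
    TournamentCounts.hadamard Γ G at (diameter-2⇒tournament Γ G at gt diam) arc
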